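{- For all positive integers $n,k$, the Callan polynomial satisfies \[ C_n^k(x)=\sum_{j=0}^{\min(n,k)}j!\,(x+1)^{\overline{j}}\genfrac{\{}{\}}{0pt}{}{n+1}{j+1}\genfrac{\{}{\}}{0pt}{}{k+1}{j+1}. \]
   Context: $\genfrac{\{}{\}}{0pt}{}{n}{k}$ denotes the Stirling numbers of the second kind, and $x^{\overline{j}}=x(x+1)\cdots(x+j-1)$ the rising factorial. Callan sequences: for integers $n,k\ge 0$ let $N=\{1,\dots,n\}\cup\{*\}$ and $K=\{1,\dots,k\}\cup\{*'\}$. A Callan sequence of size $n\times k$ consists of an integer $r\ge 0$, a set partition of $N$ into $r+1$ nonempty blocks $R_1,\dots,R_r,R^*$ with $*\in R^*$, and a set partition of $K$ into $r+1$ nonempty blocks $B_1,\dots,B_r,B^*$ with $*'\in B^*$, arranged as the ordered list of $r$ ordinary pairs $(B_1;R_1)\cdots(B_r;R_r)$ together with the extra pair $(B^*;R^*)$; the order of the ordinary pairs matters. A barred Callan sequence is a Callan sequence together with one bar placed in one of the $r+1$ gaps (before the first, between consecutive, or after the last ordinary pair). Let $\mathrm{BC}_n^k$ be the set of barred Callan sequences of size $n\times k$. Weight: for a word $u_1\cdots u_s$ of distinct letters from a totally ordered set, let $w(u)$ be the number of left-to-right minima (indices $i$ with $u_i<u_j$ for all $j<i$; $i=1$ always counts) minus one. For $\alpha\in\mathrm{BC}_n^k$, form the word obtained by listing from left to right the blue blocks $B_1,\dots,B_r$ of the ordinary pairs and the bar, in the order in which they appear in $\alpha$ (the extra pair is ignored);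 order these letters by declaring the bar smaller than every blue block and comparing blue blocks by their least elements. The weight $w(\alpha)$ is $w$ of this word. The Callan polynomial is $C_n^k(x)=\sum_{\alpha\in\mathrm{BC}_n^k}x^{w(\alpha)}$ for $n,k>0$. -}

module Defs where

open import Data.Nat using (ℕ; zero; suc; _+_; _*_; _∸_; _^_; _⊓_; _<ᵇ_; _!)
open import Data.Bool using (Bool; true; false; if_then_else_; _∧_)
open import Data.Fin using (Fin; toℕ)
open import Data.Fin.Properties using () renaming (_≟_ to _≟F_)
open import Data.Maybe using (Maybe; just; nothing)
open import Data.Vec using (Vec; []; _∷_)
open import Data.List using (List; []; _∷_; [_]; map; upTo; allFin; concatMap; take; drop; _++_)
open import Data.Nat.ListAction using (sum)
open import Data.Bool.ListAction using (and)
open import Relation.Nullary using (does)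

Σ< : ℕ → (ℕ → ℕ) → ℕ
Σ< m f = sum (map f (upTo m))

S₂ : ℕ → ℕ → ℕ
S₂ zero    zero    = 1
S₂ zero    (suc k) = 0
S₂ (suc n) zero    = 0
S₂ (suc n) (suc k) = suc k * S₂ n (suc k) + S₂ n k

rising : ℕ → ℕ → ℕ
rising x zero    = 1
rising x (suc j) = rising x j * (x + j)

-- Encoding of Callan sequences with r ordinary pairs.
-- A labelling  v : Vec (Maybe (Fin r)) m  of the ordinary elements
-- 1..m (position p of the vector is element p+1) assigns each element
-- to the ordinary block number i (just i) or to the extra block
-- (nothing; the extra block also contains the star).  The ordered
-- ordinary blocks must be nonempty: every i : Fin r occurs.

allLabels : (r : ℕ) → List (Maybe (Fin r))
allLabels r = nothing ∷ map just (allFin r)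

allVecs : {A : Set} → List A → (m : ℕ) → List (Vec A m)
allVecs xs zero    = [ [] ]
allVecs xs (suc m) = concatMap (λ a → map (a ∷_) (allVecs xs m)) xs

_==L_ : {r : ℕ} → Maybe (Fin r) → Fin r → Bool
just j  ==L i = does (j ≟F i)
nothing ==L i = false

occurs : {r m : ℕ} → Fin r → Vec (Maybe (Fin r)) m → Bool
occurs i []       = false
occurs i (a ∷ as) = (a ==L i) Data.Bool.∨ occurs i as

ordSurj : {r m : ℕ} → Vec (Maybe (Fin r)) m → Bool
ordSurj {r} v = and (map (λ i → occurs i v) (allFin r))

-- least element of block i, as an element of {1,…,m}
leastElt : {r m : ℕ} → Vec (Maybe (Fin r)) m → Fin r → ℕ
leastElt []       i = 0
leastElt (a ∷ as) i = if a ==L i then 1 else suc (leastElt as i)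

-- Letters are encoded as natural numbers: the bar is 0 and the blue
-- block B_i is its least element (≥ 1), which realises the order
-- "bar < every block, blocks compared by least elements".

lrMinFrom : Maybe ℕ → List ℕ → ℕ
lrMinFrom m        []       = 0
lrMinFrom nothing  (u ∷ us) = suc (lrMinFrom (just u) us)
lrMinFrom (just c) (u ∷ us) =
  if u <ᵇ c then suc (lrMinFrom (just u) us) else lrMinFrom (just c) us

wordWeight : List ℕ → ℕ
wordWeight u = lrMinFrom nothing u ∸ 1

-- The word of a barred Callan sequence: blue blocks B_1 … B_r in order,
-- with the bar inserted in gap b (b blocks precede the bar).
barredWord : {r k : ℕ} → Vec (Maybe (Fin r)) k → Fin (suc r) → List ℕ
barredWord {r} g b =
  let blocks = map (leastElt g) (allFin r)
  in take (toℕ b) blocks ++ 0 ∷ drop (toℕ b) blocks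

-- Callan polynomial C_n^k evaluated at x: sum over r, red labelling f
-- (of 1..n), blue labelling g (of 1..k), bar position b.
-- (r ≤ n automatically since the r ordinary red blocks are nonempty.)
callanPoly : ℕ → ℕ → ℕ → ℕ
callanPoly n k x =
  Σ< (suc n) λ r →
    sum (map (λ f →
      sum (map (λ g →
        if ordSurj f ∧ ordSurj g
        then sum (map (λ b → x ^ wordWeight (barredWord g b)) (allFin (suc r)))
        else 0)
      (allVecs (allLabels r) k)))
    (allVecs (allLabels r) n))

callanRHS : ℕ → ℕ → ℕ → ℕ
callanRHS n k x =
  Σ< (suc (n ⊓ k)) λ j →
    j ! * rising (x + 1) j * S₂ (suc n) (suc j) * S₂ (suc k) (suc j)

module Submission where

-- Red and blue parts are independent, so the
-- summand for r is (number of red labellings)·(blue sum B(k,r)).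
-- B is computed by a recurrence in k.  The new largest element k+1 either joins one
-- of the r+1 blocks of a surjective labelling, leaving the word of least elements
-- unchanged, or is alone in a new ordinary block j.  Then k+1 is a new maximum
-- inserted into that word at position j, and summing over j multiplies the bar sum
-- by x+r+1 (barSum-new-max).  So B(k+1,r+1) = (r+2)·B(k,r+1) + (x+r+1)·B(k,r), the
-- recurrence of (x+1)^(rising r)·S(k+1,r+1).  At x = 1 the same computation counts
-- the red labellings as r!·S(n+1,r+1).  Terms with r > min(n,k) vanish.

open import Defs
open import Data.Nat using (ℕ; zero; suc; _+_; _*_; _∸_; _^_; _⊓_; _<ᵇ_; _!; _≤_; _<_; _≥_; z≤n; s≤s)
open import Data.Nat.Properties
open import Algebra.Properties.CommutativeSemigroup +-commutativeSemigroup using () renaming (interchange to +-interchange; x∙yz≈y∙xz to +-left-comm)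
open import Data.Nat.ListAction using (sum)
open import Data.Nat.ListAction.Properties using (sum-++)
open import Data.Nat.Tactic.RingSolver using (solve-∀)
open import Data.Bool using (Bool; true; false; T; if_then_else_; _∧_; _∨_)
open import Data.Bool.Properties using (T-≡; ∨-assoc; ∨-identityʳ; ∨-zeroʳ)
open import Data.Bool.ListAction using (and)
open import Data.Fin using (Fin; toℕ; punchIn) renaming (zero to fzero; suc to fsuc)
open import Data.Fin.Properties using (punchIn-injective; punchInᵢ≢i) renaming (_≟_ to _≟F_)
open import Data.Maybe using (Maybe; just; nothing)
import Data.Maybe
open import Data.Vec using (Vec; []; _∷_; _∷ʳ_)
import Data.Vec
open import Data.List using (List; []; _∷_; [_]; map; applyUpTo; allFin; tabulate; concatMap; take; drop; _++_; length)
open import Data.List.Properties using (map-++; map-cong; map-tabulate; length-map; length-tabulate)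
open import Data.List.Relation.Unary.All using (All; []; _∷_)
open import Data.List.Relation.Unary.All.Properties using (map⁺; tabulate⁺)
open import Data.Product using (Σ; _,_)
open import Data.Sum using (inj₁; inj₂)
open import Data.Unit using (tt)
open import Data.Empty using (⊥-elim)
open import Function using (_∘_; id)
open import Function.Bundles using (Equivalence)
open import Relation.Nullary using (yes; no)
open import Relation.Nullary.Decidable using (dec-true; dec-false)
open import Relation.Binary.PropositionalEquality hiding ([_])

∑ : {A : Set} → List A → (A → ℕ) → ℕ
∑ xs f = sum (map f xs)

module _ {A : Set} where

  ∑-cong : (xs : List A) {f g : A → ℕ} → (∀ a → f a ≡ g a) → ∑ xs f ≡ ∑ xs g
  ∑-cong []       f≡g = refl
  ∑-cong (x ∷ xs) f≡g = cong₂ _+_ (f≡g x) (∑-cong xs f≡g)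

  ∑-+ : (xs : List A) (f g : A → ℕ) → ∑ xs (λ a → f a + g a) ≡ ∑ xs f + ∑ xs g
  ∑-+ []       f g = refl
  ∑-+ (x ∷ xs) f g = begin
    (f x + g x) + ∑ xs (λ a → f a + g a) ≡⟨ cong (f x + g x +_) (∑-+ xs f g) ⟩
    (f x + g x) + (∑ xs f + ∑ xs g)      ≡⟨ +-interchange (f x) (g x) _ _ ⟩
    (f x + ∑ xs f) + (g x + ∑ xs g)      ∎
    where open ≡-Reasoning

  ∑-* : (xs : List A) (c : ℕ) (f : A → ℕ) → ∑ xs (λ a → c * f a) ≡ c * ∑ xs f
  ∑-* []       c f = sym (*-zeroʳ c)
  ∑-* (x ∷ xs) c f = trans (cong (c * f x +_) (∑-* xs c f)) (sym (*-distribˡ-+ c (f x) _))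

  ∑-zero : (xs : List A) → ∑ xs (λ _ → 0) ≡ 0
  ∑-zero []       = refl
  ∑-zero (x ∷ xs) = ∑-zero xs

  ∑-const : (xs : List A) (c : ℕ) → ∑ xs (λ _ → c) ≡ length xs * c
  ∑-const []       c = refl
  ∑-const (x ∷ xs) c = cong (c +_) (∑-const xs c)

  ∑-indicator : (xs : List A) (p : A → Bool) (c : ℕ) →
    ∑ xs (λ a → if p a then c else 0) ≡ ∑ xs (λ a → if p a then 1 else 0) * c
  ∑-indicator []       p c = refl
  ∑-indicator (x ∷ xs) p c with p x
  ... | true  = cong (c +_) (∑-indicator xs p c)
  ... | false = ∑-indicator xs p c

module _ {A B : Set} where

  ∑-map : (xs : List A) (g : A → B) (f : B → ℕ) → ∑ (map g xs) f ≡ ∑ xs (f ∘ g)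
  ∑-map []       g f = refl
  ∑-map (x ∷ xs) g f = cong (f (g x) +_) (∑-map xs g f)

  ∑-concatMap : (xs : List A) (g : A → List B) (f : B → ℕ) →
    ∑ (concatMap g xs) f ≡ ∑ xs (λ a → ∑ (g a) f)
  ∑-concatMap []       g f = refl
  ∑-concatMap (x ∷ xs) g f = begin
    sum (map f (g x ++ concatMap g xs))         ≡⟨ cong sum (map-++ f (g x) (concatMap g xs)) ⟩
    sum (map f (g x) ++ map f (concatMap g xs)) ≡⟨ sum-++ (map f (g x)) _ ⟩
    ∑ (g x) f + ∑ (concatMap g xs) f            ≡⟨ cong (∑ (g x) f +_) (∑-concatMap xs g f) ⟩
    ∑ (g x) f + ∑ xs (λ a → ∑ (g a) f)          ∎
    where open ≡-Reasoning

  ∑-swap : (xs : List A) (ys : List B) (F : A → B → ℕ) →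
    ∑ xs (λ a → ∑ ys (F a)) ≡ ∑ ys (λ b → ∑ xs (λ a → F a b))
  ∑-swap []       ys F = sym (∑-zero ys)
  ∑-swap (x ∷ xs) ys F =
    trans (cong (∑ ys (F x) +_) (∑-swap xs ys F))
          (sym (∑-+ ys (F x) (λ b → ∑ xs (λ a → F a b))))

if-* : (b : Bool) (c w : ℕ) → (if b then c * w else 0) ≡ c * (if b then w else 0)
if-* true  c w = refl
if-* false c w = sym (*-zeroʳ c)

sumBelow : ℕ → (ℕ → ℕ) → ℕ
sumBelow zero    f = 0
sumBelow (suc n) f = f 0 + sumBelow n (f ∘ suc)

Σ<≡sumBelow : (n : ℕ) (f : ℕ → ℕ) → Σ< n f ≡ sumBelow n f
Σ<≡sumBelow n f = go n id
  where
  go : (n : ℕ) (g : ℕ → ℕ) → ∑ (applyUpTo g n) f ≡ sumBelow n (f ∘ g)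
  go zero    g = refl
  go (suc n) g = cong (f (g 0) +_) (go n (g ∘ suc))

∑-allFin : (n : ℕ) (f : ℕ → ℕ) → ∑ (allFin n) (f ∘ toℕ) ≡ sumBelow n f
∑-allFin n f = trans (cong sum (map-tabulate {n = n} id (f ∘ toℕ))) (go n f)
  where
  go : (n : ℕ) (f : ℕ → ℕ) → sum (tabulate {n = n} (f ∘ toℕ)) ≡ sumBelow n f
  go zero    f = refl
  go (suc n) f = cong (f 0 +_) (go n (f ∘ suc))

sumBelow-cong : (n : ℕ) {f g : ℕ → ℕ} → (∀ i → i < n → f i ≡ g i) → sumBelow n f ≡ sumBelow n g
sumBelow-cong zero    f≡g = refl
sumBelow-cong (suc n) f≡g = cong₂ _+_ (f≡g 0 (s≤s z≤n)) (sumBelow-cong n (λ i i<n → f≡g (suc i) (s≤s i<n)))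

sumBelow-+ : (n : ℕ) (f g : ℕ → ℕ) → sumBelow n (λ i → f i + g i) ≡ sumBelow n f + sumBelow n g
sumBelow-+ n f g = begin
  sumBelow n (λ i → f i + g i)                 ≡⟨ sym (∑-allFin n (λ i → f i + g i)) ⟩
  ∑ (allFin n) (λ i → f (toℕ i) + g (toℕ i))   ≡⟨ ∑-+ (allFin n) (f ∘ toℕ) (g ∘ toℕ) ⟩
  ∑ (allFin n) (f ∘ toℕ) + ∑ (allFin n) (g ∘ toℕ) ≡⟨ cong₂ _+_ (∑-allFin n f) (∑-allFin n g) ⟩
  sumBelow n f + sumBelow n g                  ∎
  where open ≡-Reasoning

sumBelow-* : (n c : ℕ) (f : ℕ → ℕ) → sumBelow n (λ i → c * f i) ≡ c * sumBelow n f
sumBelow-* zero    c f = sym (*-zeroʳ c)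
sumBelow-* (suc n) c f = trans (cong (c * f 0 +_) (sumBelow-* n c (f ∘ suc))) (sym (*-distribˡ-+ c (f 0) _))

sumBelow-const : (n c : ℕ) → sumBelow n (λ _ → c) ≡ n * c
sumBelow-const zero    c = refl
sumBelow-const (suc n) c = cong (c +_) (sumBelow-const n c)

sumBelow-split : (a b : ℕ) (f : ℕ → ℕ) → sumBelow (a + b) f ≡ sumBelow a f + sumBelow b (λ i → f (a + i))
sumBelow-split zero    b f = refl
sumBelow-split (suc a) b f = trans (cong (f 0 +_) (sumBelow-split a b (f ∘ suc))) (sym (+-assoc (f 0) _ _))

sumBelow-last : (n : ℕ) (f : ℕ → ℕ) → sumBelow (suc n) f ≡ sumBelow n f + f n
sumBelow-last zero    f = +-comm (f 0) 0
sumBelow-last (suc n) f = trans (cong (f 0 +_) (sumBelow-last n (f ∘ suc))) (sym (+-assoc (f 0) _ _))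

sumBelow-truncate : (m n : ℕ) (f : ℕ → ℕ) → m ≤ n → (∀ i → m ≤ i → f i ≡ 0) → sumBelow n f ≡ sumBelow m f
sumBelow-truncate m n f m≤n vanish = begin
  sumBelow n f                                   ≡⟨ cong (λ l → sumBelow l f) (sym (m+[n∸m]≡n m≤n)) ⟩
  sumBelow (m + (n ∸ m)) f                       ≡⟨ sumBelow-split m (n ∸ m) f ⟩
  sumBelow m f + sumBelow (n ∸ m) (λ i → f (m + i)) ≡⟨ cong (sumBelow m f +_) tail≡0 ⟩
  sumBelow m f + 0                               ≡⟨ +-identityʳ _ ⟩
  sumBelow m f                                   ∎
  where
  open ≡-Reasoning
  tail≡0 : sumBelow (n ∸ m) (λ i → f (m + i)) ≡ 0
  tail≡0 = trans (sumBelow-cong (n ∸ m) (λ i _ → vanish (m + i) (m≤m+n m i)))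
                 (trans (sumBelow-const (n ∸ m) 0) (*-zeroʳ (n ∸ m)))

-- ins p y xs inserts y before position p of xs (at the end if p ≥ length xs).
-- It describes both the bar in a barred word and a new block among the old ones.
ins : {A : Set} → ℕ → A → List A → List A
ins zero    y xs       = y ∷ xs
ins (suc p) y []       = y ∷ []
ins (suc p) y (x ∷ xs) = x ∷ ins p y xs

module _ {A : Set} where

  take-drop≡ins : (p : ℕ) (y : A) (xs : List A) → take p xs ++ y ∷ drop p xs ≡ ins p y xs
  take-drop≡ins zero    y xs       = refl
  take-drop≡ins (suc p) y []       = refl
  take-drop≡ins (suc p) y (x ∷ xs) = cong (x ∷_) (take-drop≡ins p y xs)

  map-allFin-punchIn : {r : ℕ} (j : Fin (suc r)) (h : Fin (suc r) → A) →
    map h (allFin (suc r)) ≡ ins (toℕ j) (h j) (map (h ∘ punchIn j) (allFin r))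
  map-allFin-punchIn {r} j h = begin
    map h (allFin (suc r))                         ≡⟨ map-tabulate {n = suc r} id h ⟩
    tabulate h                                     ≡⟨ go j h ⟩
    ins (toℕ j) (h j) (tabulate (h ∘ punchIn j))   ≡⟨ cong (ins (toℕ j) (h j)) (sym (map-tabulate {n = r} id (h ∘ punchIn j))) ⟩
    ins (toℕ j) (h j) (map (h ∘ punchIn j) (allFin r)) ∎
    where
    open ≡-Reasoning
    go : {r : ℕ} (j : Fin (suc r)) (h : Fin (suc r) → A) →
      tabulate h ≡ ins (toℕ j) (h j) (tabulate (h ∘ punchIn j))
    go         fzero    h = refl
    go {suc r} (fsuc j) h = cong (h fzero ∷_) (go j (h ∘ fsuc))

  ins-nonempty : (p : ℕ) (y : A) (xs : List A) → Σ A (λ u → Σ (List A) (λ w → ins p y xs ≡ u ∷ w))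
  ins-nonempty zero    y xs       = y , xs , refl
  ins-nonempty (suc p) y []       = y , [] , refl
  ins-nonempty (suc p) y (x ∷ xs) = x , ins p y xs , refl

  All-ins : {P : A → Set} (p : ℕ) {y : A} {xs : List A} → P y → All P xs → All P (ins p y xs)
  All-ins zero    Py Pxs        = Py ∷ Pxs
  All-ins (suc p) Py []         = Py ∷ []
  All-ins (suc p) Py (Px ∷ Pxs) = Px ∷ All-ins p Py Pxs

  ins-ins-before : (b j : ℕ) (y z : A) (xs : List A) → b ≤ j → j ≤ length xs →
    ins b y (ins j z xs) ≡ ins (suc j) z (ins b y xs)
  ins-ins-before zero    j       y z xs       _         _         = refl
  ins-ins-before (suc b) (suc j) y z (x ∷ xs) (s≤s b≤j) (s≤s j≤l) = cong (x ∷_) (ins-ins-before b j y z xs b≤j j≤l)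

  ins-ins-after : (j c : ℕ) (y z : A) (xs : List A) → j ≤ c → j ≤ length xs →
    ins (suc c) y (ins j z xs) ≡ ins j z (ins c y xs)
  ins-ins-after zero    c       y z xs       _         _         = refl
  ins-ins-after (suc j) (suc c) y z (x ∷ xs) (s≤s j≤c) (s≤s j≤l) = cong (x ∷_) (ins-ins-after j c y z xs j≤c j≤l)

sum-ins : (p y : ℕ) (xs : List ℕ) → sum (ins p y xs) ≡ y + sum xs
sum-ins zero    y xs       = refl
sum-ins (suc p) y []       = refl
sum-ins (suc p) y (x ∷ xs) = trans (cong (x +_) (sum-ins p y xs)) (+-left-comm x y (sum xs))

and-ins : (p : ℕ) (y : Bool) (xs : List Bool) → and (ins p y xs) ≡ y ∧ and xs
and-ins zero    y     xs       = refl
and-ins (suc p) y     []       = refl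
and-ins (suc p) y     (x ∷ xs) rewrite and-ins p y xs with x | y
... | true  | _     = refl
... | false | true  = refl
... | false | false = refl

<ᵇ-true : ∀ {u c} → u < c → (u <ᵇ c) ≡ true
<ᵇ-true u<c = Equivalence.to T-≡ (<⇒<ᵇ u<c)

<ᵇ-false : ∀ {c M} → c < M → (M <ᵇ c) ≡ false
<ᵇ-false {c} {M} c<M with M <ᵇ c in eq
... | false = refl
... | true  = ⊥-elim (<-asym c<M (<ᵇ⇒< M c (subst T (sym eq) tt)))

lrMin-ins-large : (c M p : ℕ) (w : List ℕ) → c < M → All (_< M) w →
  lrMinFrom (just c) (ins p M w) ≡ lrMinFrom (just c) w
lrMin-ins-large c M zero    w       c<M _ rewrite <ᵇ-false c<M = refl
lrMin-ins-large c M (suc p) []      c<M _ rewrite <ᵇ-false c<M = refl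
lrMin-ins-large c M (suc p) (u ∷ w) c<M (u<M ∷ w<M) with u <ᵇ c
... | true  = cong suc (lrMin-ins-large u M p w u<M w<M)
... | false = lrMin-ins-large c M p w c<M w<M

weight-max-front : (M u : ℕ) (w : List ℕ) → All (_< M) (u ∷ w) →
  wordWeight (M ∷ u ∷ w) ≡ suc (wordWeight (u ∷ w))
weight-max-front M u w (u<M ∷ _) rewrite <ᵇ-true u<M = refl

weight-max-later : (M p u : ℕ) (w : List ℕ) → All (_< M) (u ∷ w) →
  wordWeight (ins (suc p) M (u ∷ w)) ≡ wordWeight (u ∷ w)
weight-max-later M p u w (u<M ∷ w<M) = lrMin-ins-large u M p w u<M w<M

module BarSum (x : ℕ) where

  barTerm : List ℕ → ℕ → ℕ
  barTerm Ls b = x ^ wordWeight (ins b 0 Ls)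

  barSum : ℕ → List ℕ → ℕ
  barSum r Ls = sumBelow (suc r) (barTerm Ls)

  -- The factor picked up by inserting a new maximal block at position j.
  frontFactor : ℕ → ℕ
  frontFactor zero    = x
  frontFactor (suc _) = 1

  barTerm-ins-max : (M j c : ℕ) (Ls : List ℕ) → 0 < M → All (_< M) Ls →
    x ^ wordWeight (ins j M (ins c 0 Ls)) ≡ frontFactor j * barTerm Ls c
  barTerm-ins-max M j c Ls 0<M Ls<M
    with ins-nonempty c 0 Ls | All-ins {P = _< M} c 0<M Ls<M
  ... | u , w , eq | barred<M rewrite eq = by-position j
    where
    by-position : (j : ℕ) → x ^ wordWeight (ins j M (u ∷ w)) ≡ frontFactor j * x ^ wordWeight (u ∷ w)
    by-position zero    rewrite weight-max-front M u w barred<M = refl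
    by-position (suc j) rewrite weight-max-later M j u w barred<M = sym (*-identityˡ _)

  -- With the new maximum at position j, bar positions b ≤ j see the old word and
  -- bar positions b > j see the old word with the bar at b-1, times frontFactor j.
  barSum-ins-max : (r M j : ℕ) (Ls : List ℕ) → j ≤ r → length Ls ≡ r → 0 < M → All (_< M) Ls →
    barSum (suc r) (ins j M Ls) ≡
      sumBelow (suc j) (barTerm Ls) + frontFactor j * sumBelow (suc r ∸ j) (λ i → barTerm Ls (j + i))
  barSum-ins-max r M j Ls j≤r len 0<M Ls<M = begin
    sumBelow (suc (suc r)) new                           ≡⟨ cong (λ l → sumBelow l new) (sym split-point) ⟩
    sumBelow (suc j + (suc r ∸ j)) new                   ≡⟨ sumBelow-split (suc j) (suc r ∸ j) new ⟩
    sumBelow (suc j) new + sumBelow (suc r ∸ j) (λ i → new (suc j + i))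
      ≡⟨ cong₂ _+_ (sumBelow-cong (suc j) before) (sumBelow-cong (suc r ∸ j) after) ⟩
    sumBelow (suc j) (barTerm Ls) + sumBelow (suc r ∸ j) (λ i → frontFactor j * barTerm Ls (j + i))
      ≡⟨ cong (sumBelow (suc j) (barTerm Ls) +_) (sumBelow-* (suc r ∸ j) (frontFactor j) _) ⟩
    sumBelow (suc j) (barTerm Ls) + frontFactor j * sumBelow (suc r ∸ j) (λ i → barTerm Ls (j + i)) ∎
    where
    open ≡-Reasoning
    new : ℕ → ℕ
    new = barTerm (ins j M Ls)
    j≤len : j ≤ length Ls
    j≤len = subst (j ≤_) (sym len) j≤r
    split-point : suc j + (suc r ∸ j) ≡ suc (suc r)
    split-point = cong suc (m+[n∸m]≡n (m≤n⇒m≤1+n j≤r))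
    before : ∀ b → b < suc j → new b ≡ barTerm Ls b
    before b (s≤s b≤j) = begin
      x ^ wordWeight (ins b 0 (ins j M Ls))       ≡⟨ cong (λ z → x ^ wordWeight z) (ins-ins-before b j 0 M Ls b≤j j≤len) ⟩
      x ^ wordWeight (ins (suc j) M (ins b 0 Ls)) ≡⟨ barTerm-ins-max M (suc j) b Ls 0<M Ls<M ⟩
      1 * barTerm Ls b                            ≡⟨ *-identityˡ _ ⟩
      barTerm Ls b                                ∎
    after : ∀ i → i < suc r ∸ j → new (suc j + i) ≡ frontFactor j * barTerm Ls (j + i)
    after i _ = trans (cong (λ z → x ^ wordWeight z) (ins-ins-after j (j + i) 0 M Ls (m≤m+n j i) j≤len))
                      (barTerm-ins-max M j (j + i) Ls 0<M Ls<M)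

  -- Summing over the r+1 positions of a new maximal block multiplies the bar sum
  -- by x + r + 1: position 0 contributes G 0 + x·W and position j' + 1 contributes
  -- W + G (j' + 1), where W is the bar sum and G its terms.
  barSum-new-max : (r M : ℕ) (Ls : List ℕ) → length Ls ≡ r → 0 < M → All (_< M) Ls →
    sumBelow (suc r) (λ j → barSum (suc r) (ins j M Ls)) ≡ (x + suc r) * barSum r Ls
  barSum-new-max r M Ls len 0<M Ls<M = begin
    sumBelow (suc r) (λ j → barSum (suc r) (ins j M Ls))
      ≡⟨ sumBelow-cong (suc r) (λ j j≤r → barSum-ins-max r M j Ls (≤-pred j≤r) len 0<M Ls<M) ⟩
    H 0 + sumBelow r (H ∘ suc)              ≡⟨ cong (H 0 +_) (sumBelow-cong r later) ⟩
    H 0 + sumBelow r (λ j → W + G (suc j))  ≡⟨ cong (H 0 +_) (sumBelow-+ r (λ _ → W) (G ∘ suc)) ⟩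
    H 0 + (sumBelow r (λ _ → W) + R)        ≡⟨ cong (λ z → H 0 + (z + R)) (sumBelow-const r W) ⟩
    (G 0 + 0) + x * (G 0 + R) + (r * (G 0 + R) + R) ≡⟨ collect (G 0) R x r ⟩
    (x + suc r) * W                         ∎
    where
    open ≡-Reasoning
    G : ℕ → ℕ
    G = barTerm Ls
    W R : ℕ
    W = barSum r Ls
    R = sumBelow r (G ∘ suc)
    H : ℕ → ℕ
    H j = sumBelow (suc j) G + frontFactor j * sumBelow (suc r ∸ j) (λ i → G (j + i))
    later : ∀ j → j < r → H (suc j) ≡ W + G (suc j)
    later j j<r = begin
      sumBelow (suc (suc j)) G + 1 * rest              ≡⟨ cong (λ z → z + 1 * rest) (sumBelow-last (suc j) G) ⟩
      (sumBelow (suc j) G + G (suc j)) + 1 * rest      ≡⟨ regroup (sumBelow (suc j) G) (G (suc j)) rest ⟩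
      (sumBelow (suc j) G + rest) + G (suc j)          ≡⟨ cong (_+ G (suc j)) (sym (sumBelow-split (suc j) (r ∸ j) G)) ⟩
      sumBelow (suc j + (r ∸ j)) G + G (suc j)         ≡⟨ cong (λ l → sumBelow (suc l) G + G (suc j)) (m+[n∸m]≡n (<⇒≤ j<r)) ⟩
      W + G (suc j)                                    ∎
      where
      rest : ℕ
      rest = sumBelow (r ∸ j) (λ i → G (suc j + i))
      regroup : ∀ a g b → (a + g) + 1 * b ≡ (a + b) + g
      regroup = solve-∀
    collect : ∀ g₀ R x r → (g₀ + 0) + x * (g₀ + R) + (r * (g₀ + R) + R) ≡ (x + suc r) * (g₀ + R)
    collect = solve-∀

module _ {A : Set} where

  and-map-mono : (xs : List A) (P Q : A → Bool) → (∀ a → P a ≡ true → Q a ≡ true) →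
    and (map P xs) ≡ true → and (map Q xs) ≡ true
  and-map-mono []       P Q P⇒Q _ = refl
  and-map-mono (x ∷ xs) P Q P⇒Q allP with P x in Px
  ... | true rewrite P⇒Q x Px = and-map-mono xs P Q P⇒Q allP

  map-cong-and : {B : Set} (xs : List A) (P : A → Bool) (f g : A → B) →
    (∀ a → P a ≡ true → f a ≡ g a) → and (map P xs) ≡ true → map f xs ≡ map g xs
  map-cong-and []       P f g f≡g _ = refl
  map-cong-and (x ∷ xs) P f g f≡g allP with P x in Px
  ... | true = cong₂ _∷_ (f≡g x Px) (map-cong-and xs P f g f≡g allP)

Labelling : ℕ → ℕ → Set
Labelling r m = Vec (Maybe (Fin r)) m

blocks : {r m : ℕ} → Labelling r m → List ℕ
blocks {r} g = map (leastElt g) (allFin r)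

-- lift j relabels with r blocks into r+1 blocks, leaving block j empty.
lift : {r : ℕ} → Fin (suc r) → Maybe (Fin r) → Maybe (Fin (suc r))
lift j = Data.Maybe.map (punchIn j)

liftLabelling : {r m : ℕ} → Fin (suc r) → Labelling r m → Labelling (suc r) m
liftLabelling j = Data.Vec.map (lift j)

module _ {r : ℕ} (j : Fin (suc r)) where

  lift-==L : (a : Maybe (Fin r)) (i : Fin r) → (lift j a ==L punchIn j i) ≡ (a ==L i)
  lift-==L nothing  i = refl
  lift-==L (just b) i with b ≟F i
  ... | yes refl = dec-true (punchIn j b ≟F punchIn j b) refl
  ... | no  b≢i  = dec-false (punchIn j b ≟F punchIn j i) (b≢i ∘ punchIn-injective j b i)

  lift-==L-self : (a : Maybe (Fin r)) → (lift j a ==L j) ≡ false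
  lift-==L-self nothing  = refl
  lift-==L-self (just b) = dec-false (punchIn j b ≟F j) (punchInᵢ≢i j b)

  occurs-lift : {m : ℕ} (i : Fin r) (u : Labelling r m) →
    occurs (punchIn j i) (liftLabelling j u) ≡ occurs i u
  occurs-lift i []      = refl
  occurs-lift i (b ∷ u) rewrite lift-==L b i = cong ((b ==L i) ∨_) (occurs-lift i u)

  occurs-lift-self : {m : ℕ} (u : Labelling r m) → occurs j (liftLabelling j u) ≡ false
  occurs-lift-self []      = refl
  occurs-lift-self (b ∷ u) rewrite lift-==L-self b = occurs-lift-self u

  leastElt-lift : {m : ℕ} (i : Fin r) (u : Labelling r m) →
    leastElt (liftLabelling j u) (punchIn j i) ≡ leastElt u i
  leastElt-lift i []      = refl
  leastElt-lift i (b ∷ u) rewrite lift-==L b i with b ==L i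
  ... | true  = refl
  ... | false = cong suc (leastElt-lift i u)

module _ {r : ℕ} where

  occurs-snoc : {m : ℕ} (i : Fin r) (v : Labelling r m) (a : Maybe (Fin r)) →
    occurs i (v ∷ʳ a) ≡ occurs i v ∨ (a ==L i)
  occurs-snoc i []      a = ∨-identityʳ _
  occurs-snoc i (b ∷ v) a rewrite occurs-snoc i v a = sym (∨-assoc (b ==L i) _ _)

  leastElt-snoc-old : {m : ℕ} (i : Fin r) (v : Labelling r m) (a : Maybe (Fin r)) →
    occurs i v ≡ true → leastElt (v ∷ʳ a) i ≡ leastElt v i
  leastElt-snoc-old i (b ∷ v) a occ with b ==L i
  ... | true  = refl
  ... | false = cong suc (leastElt-snoc-old i v a occ)

  leastElt-snoc-new : {m : ℕ} (i : Fin r) (v : Labelling r m) (a : Maybe (Fin r)) →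
    occurs i v ≡ false → leastElt (v ∷ʳ a) i ≡ suc m
  leastElt-snoc-new i []      a _ with a ==L i
  ... | true  = refl
  ... | false = refl
  leastElt-snoc-new i (b ∷ v) a occ with b ==L i
  ... | false = cong suc (leastElt-snoc-new i v a occ)

  leastElt≤ : {m : ℕ} (i : Fin r) (v : Labelling r m) → leastElt v i ≤ m
  leastElt≤ i []      = z≤n
  leastElt≤ i (b ∷ v) with b ==L i
  ... | true  = s≤s z≤n
  ... | false = s≤s (leastElt≤ i v)

  ordSurj-snoc-nothing : {m : ℕ} (v : Labelling r m) → ordSurj (v ∷ʳ nothing) ≡ ordSurj v
  ordSurj-snoc-nothing v =
    cong and (map-cong (λ i → trans (occurs-snoc i v nothing) (∨-identityʳ _)) (allFin r))

  ordSurj-snoc-surj : {m : ℕ} (v : Labelling r m) (a : Maybe (Fin r)) →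
    ordSurj v ≡ true → ordSurj (v ∷ʳ a) ≡ true
  ordSurj-snoc-surj v a = and-map-mono (allFin r) (λ i → occurs i v) (λ i → occurs i (v ∷ʳ a))
    (λ i occ → trans (occurs-snoc i v a) (cong (_∨ (a ==L i)) occ))

  blocks-snoc-surj : {m : ℕ} (v : Labelling r m) (a : Maybe (Fin r)) →
    ordSurj v ≡ true → blocks (v ∷ʳ a) ≡ blocks v
  blocks-snoc-surj v a = map-cong-and (allFin r) (λ i → occurs i v) _ _ (λ i occ → leastElt-snoc-old i v a occ)

module _ {r : ℕ} (j : Fin (suc r)) where

  othersOccur : {m : ℕ} → Labelling (suc r) m → Bool
  othersOccur v = and (map (λ i → occurs (punchIn j i) v) (allFin r))

  ordSurj-split : {m : ℕ} (v : Labelling (suc r) m) → ordSurj v ≡ occurs j v ∧ othersOccur v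
  ordSurj-split v = trans (cong and (map-allFin-punchIn j (λ i → occurs i v))) (and-ins (toℕ j) _ _)

  ordSurj-snoc-into : {m : ℕ} (v : Labelling (suc r) m) → ordSurj (v ∷ʳ just j) ≡ othersOccur v
  ordSurj-snoc-into v = trans (ordSurj-split (v ∷ʳ just j)) (cong₂ _∧_ j-occurs others)
    where
    j-occurs : occurs j (v ∷ʳ just j) ≡ true
    j-occurs = trans (occurs-snoc j v (just j))
                     (trans (cong (occurs j v ∨_) (dec-true (j ≟F j) refl)) (∨-zeroʳ _))
    other : ∀ i → occurs (punchIn j i) (v ∷ʳ just j) ≡ occurs (punchIn j i) v
    other i = trans (occurs-snoc (punchIn j i) v (just j))
      (trans (cong (occurs (punchIn j i) v ∨_) (dec-false (j ≟F punchIn j i) (punchInᵢ≢i j i ∘ sym)))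
             (∨-identityʳ _))
    others : othersOccur (v ∷ʳ just j) ≡ othersOccur v
    others = cong and (map-cong other (allFin r))

  othersOccur-lift : {m : ℕ} (u : Labelling r m) → othersOccur (liftLabelling j u) ≡ ordSurj u
  othersOccur-lift u = cong and (map-cong (λ i → occurs-lift j i u) (allFin r))

  blocks-new-block : {m : ℕ} (u : Labelling r m) → ordSurj u ≡ true →
    blocks (liftLabelling j u ∷ʳ just j) ≡ ins (toℕ j) (suc m) (blocks u)
  blocks-new-block u surj = trans (map-allFin-punchIn j (leastElt g))
    (cong₂ (ins (toℕ j)) (leastElt-snoc-new j (liftLabelling j u) (just j) (occurs-lift-self j u))
      (map-cong-and (allFin r) (λ i → occurs i u) _ _ old-block surj))
    where
    g : Labelling (suc r) _
    g = liftLabelling j u ∷ʳ just j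
    old-block : ∀ i → occurs i u ≡ true → leastElt g (punchIn j i) ≡ leastElt u i
    old-block i occ = trans (leastElt-snoc-old (punchIn j i) (liftLabelling j u) (just j) (trans (occurs-lift j i u) occ))
                            (leastElt-lift j i u)

∑-allVecs-snoc : {A : Set} (xs : List A) (m : ℕ) (F : Vec A (suc m) → ℕ) →
  ∑ (allVecs xs (suc m)) F ≡ ∑ (allVecs xs m) (λ v → ∑ xs (λ a → F (v ∷ʳ a)))
∑-allVecs-snoc xs zero F =
  trans (∑-concatMap xs (λ a → map (a ∷_) [ [] ]) F)
    (trans (∑-cong xs (λ a → +-identityʳ (F (a ∷ [])))) (sym (+-identityʳ _)))
∑-allVecs-snoc xs (suc m) F = begin
  ∑ (allVecs xs (suc (suc m))) F
    ≡⟨ ∑-concatMap xs (λ a → map (a ∷_) (allVecs xs (suc m))) F ⟩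
  ∑ xs (λ a → ∑ (map (a ∷_) (allVecs xs (suc m))) F)
    ≡⟨ ∑-cong xs (λ a → trans (∑-map (allVecs xs (suc m)) (a ∷_) F) (∑-allVecs-snoc xs m (λ w → F (a ∷ w)))) ⟩
  ∑ xs (λ a → ∑ (allVecs xs m) (λ w → G (a ∷ w)))
    ≡⟨ sym (∑-cong xs (λ a → ∑-map (allVecs xs m) (a ∷_) G)) ⟩
  ∑ xs (λ a → ∑ (map (a ∷_) (allVecs xs m)) G)
    ≡⟨ sym (∑-concatMap xs (λ a → map (a ∷_) (allVecs xs m)) G) ⟩
  ∑ (allVecs xs (suc m)) G ∎
  where
  open ≡-Reasoning
  G : Vec _ (suc m) → ℕ
  G w = ∑ xs (λ a → F (w ∷ʳ a))

module _ {r : ℕ} (j : Fin (suc r)) where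

  ∑-labels-avoiding : (K : Maybe (Fin (suc r)) → ℕ) →
    ∑ (allLabels (suc r)) (λ a → if a ==L j then 0 else K a) ≡ ∑ (allLabels r) (K ∘ lift j)
  ∑-labels-avoiding K = cong (K nothing +_) (begin
    ∑ (map just (allFin (suc r))) h                           ≡⟨ ∑-map (allFin (suc r)) just h ⟩
    sum (map (h ∘ just) (allFin (suc r)))                     ≡⟨ cong sum (map-allFin-punchIn j (h ∘ just)) ⟩
    sum (ins (toℕ j) (h (just j)) (map (h ∘ just ∘ punchIn j) (allFin r)))  ≡⟨ sum-ins (toℕ j) _ _ ⟩
    h (just j) + ∑ (allFin r) (h ∘ just ∘ punchIn j)          ≡⟨ cong₂ _+_ h-at-j (∑-cong (allFin r) h-elsewhere) ⟩
    ∑ (allFin r) (K ∘ lift j ∘ just)                          ≡⟨ sym (∑-map (allFin r) just (K ∘ lift j)) ⟩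
    ∑ (map just (allFin r)) (K ∘ lift j)                      ∎)
    where
    open ≡-Reasoning
    h : Maybe (Fin (suc r)) → ℕ
    h a = if a ==L j then 0 else K a
    h-at-j : h (just j) ≡ 0
    h-at-j rewrite dec-true (j ≟F j) refl = refl
    h-elsewhere : ∀ i → h (just (punchIn j i)) ≡ K (lift j (just i))
    h-elsewhere i rewrite dec-false (punchIn j i ≟F j) (punchInᵢ≢i j i) = refl

  ∑-labellings-avoiding : (m : ℕ) (H : Labelling (suc r) m → ℕ) →
    ∑ (allVecs (allLabels (suc r)) m) (λ v → if occurs j v then 0 else H v) ≡
    ∑ (allVecs (allLabels r) m) (H ∘ liftLabelling j)
  ∑-labellings-avoiding zero    H = refl
  ∑-labellings-avoiding (suc m) H = begin
    ∑ (concatMap (λ a → map (a ∷_) (allVecs (allLabels (suc r)) m)) (allLabels (suc r))) avoidH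
      ≡⟨ ∑-concatMap (allLabels (suc r)) (λ a → map (a ∷_) (allVecs (allLabels (suc r)) m)) avoidH ⟩
    ∑ (allLabels (suc r)) (λ a → ∑ (map (a ∷_) (allVecs (allLabels (suc r)) m)) avoidH)
      ≡⟨ ∑-cong (allLabels (suc r)) first-letter ⟩
    ∑ (allLabels (suc r)) (λ a → if a ==L j then 0 else lifted a)
      ≡⟨ ∑-labels-avoiding lifted ⟩
    ∑ (allLabels r) (lifted ∘ lift j)
      ≡⟨ ∑-cong (allLabels r) (λ a → sym (∑-map (allVecs (allLabels r) m) (a ∷_) (H ∘ liftLabelling j))) ⟩
    ∑ (allLabels r) (λ a → ∑ (map (a ∷_) (allVecs (allLabels r) m)) (H ∘ liftLabelling j))
      ≡⟨ sym (∑-concatMap (allLabels r) (λ a → map (a ∷_) (allVecs (allLabels r) m)) (H ∘ liftLabelling j)) ⟩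
    ∑ (allVecs (allLabels r) (suc m)) (H ∘ liftLabelling j) ∎
    where
    open ≡-Reasoning
    avoidH : Labelling (suc r) (suc m) → ℕ
    avoidH v = if occurs j v then 0 else H v
    lifted : Maybe (Fin (suc r)) → ℕ
    lifted a = ∑ (allVecs (allLabels r) m) (λ u → H (a ∷ liftLabelling j u))
    first-letter : ∀ a → ∑ (map (a ∷_) (allVecs (allLabels (suc r)) m)) avoidH ≡ (if a ==L j then 0 else lifted a)
    first-letter a = trans (∑-map (allVecs (allLabels (suc r)) m) (a ∷_) avoidH) (by-letter (a ==L j))
      where
      by-letter : (isj : Bool) →
        ∑ (allVecs (allLabels (suc r)) m) (λ v → if isj ∨ occurs j v then 0 else H (a ∷ v)) ≡ (if isj then 0 else lifted a)
      by-letter true  = ∑-zero (allVecs (allLabels (suc r)) m)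
      by-letter false = ∑-labellings-avoiding m (λ v → H (a ∷ v))

module BlueSum (x : ℕ) where
  open BarSum x

  barredSum : {r m : ℕ} → Labelling r m → ℕ
  barredSum {r} g = ∑ (allFin (suc r)) (λ b → x ^ wordWeight (barredWord g b))

  surjBarredSum : {r m : ℕ} → Labelling r m → ℕ
  surjBarredSum g = if ordSurj g then barredSum g else 0

  blueSum : ℕ → ℕ → ℕ
  blueSum k r = ∑ (allVecs (allLabels r) k) surjBarredSum

  barredSum≡barSum : {r m : ℕ} (g : Labelling r m) → barredSum g ≡ barSum r (blocks g)
  barredSum≡barSum {r} g =
    trans (∑-cong (allFin (suc r)) (λ b → cong (λ w → x ^ wordWeight w) (take-drop≡ins (toℕ b) 0 (blocks g))))
          (∑-allFin (suc r) (barTerm (blocks g)))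

  -- Contributions of labellings of {1,…,k+1} whose first k elements are labelled by v
  -- that does not use block j, while k+1 opens block j.
  newBlockTerm : {r k : ℕ} → Labelling r k → ℕ
  newBlockTerm {r} v = ∑ (allFin r) (λ j → if ordSurj v then 0 else surjBarredSum (v ∷ʳ just j))

  -- Element k+1 either joins a block of a surjective v (r+1 choices, same block word)
  -- or is alone in its block.
  ∑-last-label : {r k : ℕ} (v : Labelling r k) →
    ∑ (allLabels r) (λ a → surjBarredSum (v ∷ʳ a)) ≡
    (if ordSurj v then suc r * barredSum v else 0) +
    ∑ (allFin r) (λ j → if ordSurj v then 0 else surjBarredSum (v ∷ʳ just j))
  ∑-last-label {r} v with ordSurj v in surj
  ... | true  = begin
    surjBarredSum (v ∷ʳ nothing) + ∑ (map just (allFin r)) (λ a → surjBarredSum (v ∷ʳ a))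
      ≡⟨ cong (surjBarredSum (v ∷ʳ nothing) +_) (∑-map (allFin r) just (λ a → surjBarredSum (v ∷ʳ a))) ⟩
    surjBarredSum (v ∷ʳ nothing) + ∑ (allFin r) (λ i → surjBarredSum (v ∷ʳ just i))
      ≡⟨ cong₂ _+_ (unchanged nothing) (trans (∑-cong (allFin r) (unchanged ∘ just)) (∑-const (allFin r) (barredSum v))) ⟩
    barredSum v + length (allFin r) * barredSum v
      ≡⟨ cong (λ l → barredSum v + l * barredSum v) (length-tabulate {n = r} id) ⟩
    suc r * barredSum v       ≡⟨ sym (+-identityʳ _) ⟩
    suc r * barredSum v + 0   ≡⟨ cong (suc r * barredSum v +_) (sym (∑-zero (allFin r))) ⟩
    suc r * barredSum v + ∑ (allFin r) (λ _ → 0) ∎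
    where
    open ≡-Reasoning
    unchanged : ∀ a → surjBarredSum (v ∷ʳ a) ≡ barredSum v
    unchanged a rewrite ordSurj-snoc-surj v a surj =
      trans (barredSum≡barSum (v ∷ʳ a)) (trans (cong (barSum r) (blocks-snoc-surj v a surj)) (sym (barredSum≡barSum v)))
  ... | false = cong₂ _+_ alone-in-extra (∑-map (allFin r) just (λ a → surjBarredSum (v ∷ʳ a)))
    where
    alone-in-extra : surjBarredSum (v ∷ʳ nothing) ≡ 0
    alone-in-extra rewrite ordSurj-snoc-nothing v | surj = refl

  blueSum-suc : (k r : ℕ) → blueSum (suc k) r ≡ suc r * blueSum k r + ∑ (allVecs (allLabels r) k) newBlockTerm
  blueSum-suc k r = begin
    blueSum (suc k) r
      ≡⟨ ∑-allVecs-snoc (allLabels r) k surjBarredSum ⟩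
    ∑ vs (λ v → ∑ (allLabels r) (λ a → surjBarredSum (v ∷ʳ a)))
      ≡⟨ ∑-cong vs ∑-last-label ⟩
    ∑ vs (λ v → (if ordSurj v then suc r * barredSum v else 0) + newBlockTerm v)
      ≡⟨ ∑-+ vs (λ v → if ordSurj v then suc r * barredSum v else 0) newBlockTerm ⟩
    ∑ vs (λ v → if ordSurj v then suc r * barredSum v else 0) + ∑ vs newBlockTerm
      ≡⟨ cong (_+ ∑ vs newBlockTerm) (trans (∑-cong vs (λ v → if-* (ordSurj v) (suc r) (barredSum v))) (∑-* vs (suc r) surjBarredSum)) ⟩
    suc r * blueSum k r + ∑ vs newBlockTerm ∎
    where
    open ≡-Reasoning
    vs : List (Labelling r k)
    vs = allVecs (allLabels r) k

  -- For fixed j, the labellings opening block j at element k+1 are the lifts of the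
  -- surjective labellings u with one block fewer.
  newBlockTerm-at : {r k : ℕ} (j : Fin (suc r)) (v : Labelling (suc r) k) →
    (if ordSurj v then 0 else surjBarredSum (v ∷ʳ just j)) ≡
    (if occurs j v then 0 else (if othersOccur j v then barredSum (v ∷ʳ just j) else 0))
  newBlockTerm-at j v rewrite ordSurj-split j v | ordSurj-snoc-into j v with occurs j v | othersOccur j v
  ... | true  | true  = refl
  ... | true  | false = refl
  ... | false | _     = refl

  ∑-new-block-position : {r k : ℕ} (u : Labelling r k) →
    ∑ (allFin (suc r)) (λ j → if ordSurj u then barredSum (liftLabelling j u ∷ʳ just j) else 0) ≡
    (if ordSurj u then (x + suc r) * barredSum u else 0)
  ∑-new-block-position {r} {k} u with ordSurj u in surj
  ... | false = ∑-zero (allFin (suc r))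
  ... | true  = begin
    ∑ (allFin (suc r)) (λ j → barredSum (liftLabelling j u ∷ʳ just j))
      ≡⟨ ∑-cong (allFin (suc r)) (λ j → trans (barredSum≡barSum (liftLabelling j u ∷ʳ just j)) (cong (barSum (suc r)) (blocks-new-block j u surj))) ⟩
    ∑ (allFin (suc r)) (λ j → barSum (suc r) (ins (toℕ j) (suc k) (blocks u)))
      ≡⟨ ∑-allFin (suc r) (λ j → barSum (suc r) (ins j (suc k) (blocks u))) ⟩
    sumBelow (suc r) (λ j → barSum (suc r) (ins j (suc k) (blocks u)))
      ≡⟨ barSum-new-max r (suc k) (blocks u) blocks-length (s≤s z≤n) blocks<new ⟩
    (x + suc r) * barSum r (blocks u)
      ≡⟨ cong ((x + suc r) *_) (sym (barredSum≡barSum u)) ⟩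
    (x + suc r) * barredSum u ∎
    where
    open ≡-Reasoning
    blocks-length : length (blocks u) ≡ r
    blocks-length = trans (length-map (leastElt u) (allFin r)) (length-tabulate {n = r} id)
    blocks<new : All (_< suc k) (blocks u)
    blocks<new = map⁺ (tabulate⁺ (λ i → s≤s (leastElt≤ i u)))

  ∑-newBlockTerm : (k r : ℕ) → ∑ (allVecs (allLabels (suc r)) k) newBlockTerm ≡ (x + suc r) * blueSum k r
  ∑-newBlockTerm k r = begin
    ∑ vs (λ v → ∑ (allFin (suc r)) (λ j → if ordSurj v then 0 else surjBarredSum (v ∷ʳ just j)))
      ≡⟨ ∑-swap vs (allFin (suc r)) _ ⟩
    ∑ (allFin (suc r)) (λ j → ∑ vs (λ v → if ordSurj v then 0 else surjBarredSum (v ∷ʳ just j)))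
      ≡⟨ ∑-cong (allFin (suc r)) (λ j → trans (∑-cong vs (newBlockTerm-at j)) (lifts j)) ⟩
    ∑ (allFin (suc r)) (λ j → ∑ us (λ u → if ordSurj u then barredSum (liftLabelling j u ∷ʳ just j) else 0))
      ≡⟨ sym (∑-swap us (allFin (suc r)) _) ⟩
    ∑ us (λ u → ∑ (allFin (suc r)) (λ j → if ordSurj u then barredSum (liftLabelling j u ∷ʳ just j) else 0))
      ≡⟨ ∑-cong us ∑-new-block-position ⟩
    ∑ us (λ u → if ordSurj u then (x + suc r) * barredSum u else 0)
      ≡⟨ ∑-cong us (λ u → if-* (ordSurj u) (x + suc r) (barredSum u)) ⟩
    ∑ us (λ u → (x + suc r) * surjBarredSum u)
      ≡⟨ ∑-* us (x + suc r) surjBarredSum ⟩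
    (x + suc r) * blueSum k r ∎
    where
    open ≡-Reasoning
    vs : List (Labelling (suc r) k)
    vs = allVecs (allLabels (suc r)) k
    us : List (Labelling r k)
    us = allVecs (allLabels r) k
    lifts : (j : Fin (suc r)) →
      ∑ vs (λ v → if occurs j v then 0 else (if othersOccur j v then barredSum (v ∷ʳ just j) else 0)) ≡
      ∑ us (λ u → if ordSurj u then barredSum (liftLabelling j u ∷ʳ just j) else 0)
    lifts j = trans (∑-labellings-avoiding j k (λ v → if othersOccur j v then barredSum (v ∷ʳ just j) else 0))
      (∑-cong us (λ u → cong (λ b → if b then barredSum (liftLabelling j u ∷ʳ just j) else 0) (othersOccur-lift j u)))

  blueSum-closed : (k r : ℕ) → blueSum k r ≡ rising (x + 1) r * S₂ (suc k) (suc r)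
  blueSum-closed zero    zero    = refl
  blueSum-closed zero    (suc r) = sym (trans (cong (rising (x + 1) (suc r) *_) (trans (+-identityʳ _) (*-zeroʳ (suc (suc r)))))
                                           (*-zeroʳ (rising (x + 1) (suc r))))
  blueSum-closed (suc k) zero    = begin
    blueSum (suc k) 0                             ≡⟨ blueSum-suc k 0 ⟩
    1 * blueSum k 0 + ∑ (allVecs (allLabels 0) k) newBlockTerm ≡⟨ cong₂ _+_ (cong (1 *_) (blueSum-closed k 0)) (∑-zero (allVecs (allLabels 0) k)) ⟩
    1 * (1 * S₂ (suc k) 1) + 0                    ≡⟨ arith (S₂ (suc k) 1) ⟩
    1 * (1 * S₂ (suc k) 1 + 0)                    ∎
    where
    open ≡-Reasoning
    arith : ∀ s → 1 * (1 * s) + 0 ≡ 1 * (1 * s + 0)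
    arith = solve-∀
  blueSum-closed (suc k) (suc r) = begin
    blueSum (suc k) (suc r)                                   ≡⟨ blueSum-suc k (suc r) ⟩
    suc (suc r) * blueSum k (suc r) + ∑ (allVecs (allLabels (suc r)) k) newBlockTerm
      ≡⟨ cong₂ _+_ (cong (suc (suc r) *_) (blueSum-closed k (suc r))) (trans (∑-newBlockTerm k r) (cong ((x + suc r) *_) (blueSum-closed k r))) ⟩
    suc (suc r) * (ρ * (x + 1 + r) * S₂ (suc k) (suc (suc r))) + (x + suc r) * (ρ * S₂ (suc k) (suc r))
      ≡⟨ arith ρ x r (S₂ (suc k) (suc (suc r))) (S₂ (suc k) (suc r)) ⟩
    ρ * (x + 1 + r) * (suc (suc r) * S₂ (suc k) (suc (suc r)) + S₂ (suc k) (suc r)) ∎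
    where
    open ≡-Reasoning
    ρ : ℕ
    ρ = rising (x + 1) r
    arith : ∀ ρ x r a b → suc (suc r) * (ρ * (x + 1 + r) * a) + (x + suc r) * (ρ * b) ≡ ρ * (x + 1 + r) * (suc (suc r) * a + b)
    arith = solve-∀

surjCount : ℕ → ℕ → ℕ
surjCount n r = ∑ (allVecs (allLabels r) n) (λ f → if ordSurj f then 1 else 0)

rising-2 : ∀ r → rising 2 r ≡ suc r !
rising-2 zero    = refl
rising-2 (suc r) = trans (cong (_* (2 + r)) (rising-2 r)) (*-comm (suc r !) (suc (suc r)))

-- At x = 1 every bar placement has weight 1^w = 1, so blueSum 1 n r counts
-- surjective labellings r+1 times; comparing with blueSum-closed and cancelling
-- r+1 gives the count r!·S(n+1, r+1).
surjCount-closed : ∀ n r → surjCount n r ≡ r ! * S₂ (suc n) (suc r)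
surjCount-closed n r = *-cancelʳ-≡ (surjCount n r) (r ! * S₂ (suc n) (suc r)) (suc r) (begin
  surjCount n r * suc r                       ≡⟨ sym counted ⟩
  blueSum n r                                 ≡⟨ blueSum-closed n r ⟩
  rising 2 r * S₂ (suc n) (suc r)             ≡⟨ cong (_* S₂ (suc n) (suc r)) (rising-2 r) ⟩
  (suc r * r !) * S₂ (suc n) (suc r)          ≡⟨ arith (r !) (S₂ (suc n) (suc r)) (suc r) ⟩
  (r ! * S₂ (suc n) (suc r)) * suc r          ∎)
  where
  open ≡-Reasoning
  open BlueSum 1
  fs : List (Labelling r n)
  fs = allVecs (allLabels r) n
  barredSum-at-1 : (f : Labelling r n) → barredSum f ≡ suc r
  barredSum-at-1 f = begin
    ∑ (allFin (suc r)) (λ b → 1 ^ wordWeight (barredWord f b)) ≡⟨ ∑-cong (allFin (suc r)) (λ b → ^-zeroˡ (wordWeight (barredWord f b))) ⟩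
    ∑ (allFin (suc r)) (λ _ → 1)                               ≡⟨ ∑-const (allFin (suc r)) 1 ⟩
    length (allFin (suc r)) * 1                                 ≡⟨ cong (_* 1) (length-tabulate {n = suc r} id) ⟩
    suc r * 1                                                   ≡⟨ *-identityʳ (suc r) ⟩
    suc r                                                       ∎
  counted : blueSum n r ≡ surjCount n r * suc r
  counted = trans (∑-cong fs (λ f → cong (λ w → if ordSurj f then w else 0) (barredSum-at-1 f)))
                  (∑-indicator fs ordSurj (suc r))
  arith : ∀ a b c → (c * a) * b ≡ (a * b) * c
  arith = solve-∀

callanSummand : (n k x r : ℕ) → ℕ
callanSummand n k x r =
  ∑ (allVecs (allLabels r) n) (λ f →
    ∑ (allVecs (allLabels r) k) (λ g →
      if ordSurj f ∧ ordSurj g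
      then ∑ (allFin (suc r)) (λ b → x ^ wordWeight (barredWord g b))
      else 0))

callanTerm : (n k x j : ℕ) → ℕ
callanTerm n k x j = j ! * rising (x + 1) j * S₂ (suc n) (suc j) * S₂ (suc k) (suc j)

callanSummand-closed : (n k x r : ℕ) → callanSummand n k x r ≡ callanTerm n k x r
callanSummand-closed n k x r = begin
  ∑ fs (λ f → ∑ gs (λ g → if ordSurj f ∧ ordSurj g then barredSum g else 0))
    ≡⟨ ∑-cong fs red-then-blue ⟩
  ∑ fs (λ f → if ordSurj f then blueSum k r else 0)
    ≡⟨ ∑-indicator fs ordSurj (blueSum k r) ⟩
  surjCount n r * blueSum k r
    ≡⟨ cong₂ _*_ (surjCount-closed n r) (blueSum-closed k r) ⟩
  (r ! * S₂ (suc n) (suc r)) * (rising (x + 1) r * S₂ (suc k) (suc r))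
    ≡⟨ arith (r !) (rising (x + 1) r) (S₂ (suc n) (suc r)) (S₂ (suc k) (suc r)) ⟩
  r ! * rising (x + 1) r * S₂ (suc n) (suc r) * S₂ (suc k) (suc r) ∎
  where
  open ≡-Reasoning
  open BlueSum x
  fs : List (Labelling r n)
  fs = allVecs (allLabels r) n
  gs : List (Labelling r k)
  gs = allVecs (allLabels r) k
  red-then-blue : (f : Labelling r n) →
    ∑ gs (λ g → if ordSurj f ∧ ordSurj g then barredSum g else 0) ≡ (if ordSurj f then blueSum k r else 0)
  red-then-blue f with ordSurj f
  ... | true  = refl
  ... | false = ∑-zero gs
  arith : ∀ a b c d → (a * c) * (b * d) ≡ a * b * c * d
  arith = solve-∀

S₂-vanish : ∀ a b → a < b → S₂ a b ≡ 0
S₂-vanish zero    (suc b) _         = refl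
S₂-vanish (suc a) (suc b) (s≤s a<b)
  rewrite S₂-vanish a (suc b) (m<n⇒m<1+n a<b) | S₂-vanish a b a<b = trans (+-identityʳ (suc b * 0)) (*-zeroʳ (suc b))

callanTerm-vanish : (n k x j : ℕ) → suc (n ⊓ k) ≤ j → callanTerm n k x j ≡ 0
callanTerm-vanish n k x j min<j with ≤-total n k
... | inj₁ n≤k rewrite m≤n⇒m⊓n≡m n≤k | S₂-vanish (suc n) (suc j) (s≤s min<j) =
  cong (_* S₂ (suc k) (suc j)) (*-zeroʳ (j ! * rising (x + 1) j))
... | inj₂ k≤n rewrite m≥n⇒m⊓n≡n k≤n | S₂-vanish (suc k) (suc j) (s≤s min<j) =
  *-zeroʳ (j ! * rising (x + 1) j * S₂ (suc n) (suc j))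

mainTheorem6 : (n k : ℕ) → n ≥ 1 → k ≥ 1 → (x : ℕ) →
    callanPoly n k x ≡ callanRHS n k x
mainTheorem6 n k _ _ x = begin
  callanPoly n k x                         ≡⟨ Σ<≡sumBelow (suc n) (callanSummand n k x) ⟩
  sumBelow (suc n) (callanSummand n k x)   ≡⟨ sumBelow-cong (suc n) (λ r _ → callanSummand-closed n k x r) ⟩
  sumBelow (suc n) (callanTerm n k x)      ≡⟨ sumBelow-truncate (suc (n ⊓ k)) (suc n) (callanTerm n k x)
                                                (s≤s (m⊓n≤m n k)) (callanTerm-vanish n k x) ⟩
  sumBelow (suc (n ⊓ k)) (callanTerm n k x) ≡⟨ sym (Σ<≡sumBelow (suc (n ⊓ k)) (callanTerm n k x)) ⟩
  callanRHS n k x                          ∎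
  where open ≡-Reasoning
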